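{- Let $D$ be a digraph with $n$ vertices and let $t=maxDiCut(D)$. Then $\tfrac{1}{2}nt\le val(D)\le (n-1)t$, where $val(D)$ denotes the maximum value of an arrangement of $D$.
   Context: Digraphs are simple (no loops or parallel edges; opposite edges allowed). An arrangement of an $n$-vertex digraph $D$ is a bijection $\pi:V(D)\to\{1,\dots,n\}$; for an edge $e=(u,v)$, $val_\pi(e)=\max\{0,\pi(v)-\pi(u)\}$, and $val_D(\pi)=\sum_{e\in E(D)}val_\pi(e)$. For a partition $\{X,Y\}$ of $V(D)$, $E(X,Y)$ is the set of edges with tail in $X$ and head in $Y$; $maxDiCut(D)$ is the maximum of $|E(X,Y)|$ over all such partitions. -}

module Defs where

open import Data.Bool using (Bool; true; false; if_then_else_)
open import Data.Nat using (ℕ; zero; suc; _+_; _*_; _∸_; _≤_)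
open import Data.Fin using (Fin; toℕ) renaming (zero to fzero; suc to fsuc)
open import Data.Fin.Permutation using (Permutation′; _⟨$⟩ʳ_)
open import Data.Product using (Σ; _×_)
open import Relation.Binary.PropositionalEquality using (_≡_)

sumFin : ∀ {n} → (Fin n → ℕ) → ℕ
sumFin {zero}  f = 0
sumFin {suc n} f = f fzero + sumFin (λ i → f (fsuc i))

-- A simple digraph on vertex set Fin n: adjacency relation given by a
-- Boolean matrix (so no parallel edges), with no loops.
-- Opposite edges (u,v),(v,u) are allowed.
record Digraph (n : ℕ) : Set where
  field
    adj    : Fin n → Fin n → Bool
    noLoop : ∀ v → adj v v ≡ false
open Digraph public

-- An arrangement is a bijection V(D) → {1,…,n}; we use positions Fin n
-- (i.e. {0,…,n-1}), which does not change any difference π(v) - π(u).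
Arrangement : ℕ → Set
Arrangement n = Permutation′ n

edgeVal : ∀ {n} → Arrangement n → Fin n → Fin n → ℕ
edgeVal π u v = toℕ (π ⟨$⟩ʳ v) ∸ toℕ (π ⟨$⟩ʳ u)

val : ∀ {n} → Digraph n → Arrangement n → ℕ
val D π = sumFin (λ u → sumFin (λ v → if adj D u v then edgeVal π u v else 0))

-- A partition {X, Y} of V(D) is given by the indicator of X (Y = complement).
-- |E(X,Y)| = number of edges with tail in X and head in Y.
cutSize : ∀ {n} → Digraph n → (Fin n → Bool) → ℕ
cutSize D X = sumFin (λ u → sumFin (λ v →
  if adj D u v then (if X u then (if X v then 0 else 1) else 0) else 0))

IsMaxDiCut : ∀ {n} → Digraph n → ℕ → Set
IsMaxDiCut D t = Σ (Fin _ → Bool) (λ X → cutSize D X ≡ t) × (∀ X → cutSize D X ≤ t)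

IsMaxVal : ∀ {n} → Digraph n → ℕ → Set
IsMaxVal D m = Σ (Arrangement _) (λ π → val D π ≡ m) × (∀ π → val D π ≤ m)

-- Upper bound: the n − 1 initial segments {w : π(w) ≤ k} of an arrangement π are cuts, and an
-- edge (u, v) is cut by exactly max{0, π(v) − π(u)} of them, so val_D(π) is a sum of n − 1 cut
-- sizes. Lower bound: given a maximum cut (X, Y), take two arrangements that both list X before Y,
-- with the orders inside X and inside Y reversed from one to the other. The positions of a
-- vertex in the two arrangements then sum to a constant on each block, and the two constants
-- differ by n, so every edge from X to Y contributes n to the sum of the two values.
module Submission where

open import Defs
open import Data.Nat using (ℕ; _*_; _∸_; _≤_)
open import Data.Product using (_×_)

open import Data.Bool using (Bool; true; false; if_then_else_)
open import Data.Fin using (Fin; toℕ; fromℕ; inject₁; punchIn) renaming (zero to fzero; suc to fsuc)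
open import Data.Fin.Properties using (toℕ<n; toℕ-fromℕ; toℕ-inject₁)
open import Data.Fin.Permutation using (_⟨$⟩ʳ_; insert; id)
open import Data.Nat using (zero; suc; pred; _+_; _<_; _≤ᵇ_; z≤n; s≤s; s≤s⁻¹)
open import Data.Nat.Properties
open import Algebra.Properties.Semiring.Sum +-*-semiring
  using (sum-syntax; sum-cong-≗; ∑-distrib-+; ∑-comm; *-distribˡ-sum; sum-replicate-zero)
open import Data.Product using (∃₂; _,_)
open import Relation.Binary.PropositionalEquality
  using (_≡_; refl; sym; trans; cong; cong₂; subst; module ≡-Reasoning)
open import Data.Nat.Tactic.RingSolver using (solve-∀)

private
  variable
    n : ℕ

sumFin≡∑ : (f : Fin n → ℕ) → sumFin f ≡ ∑[ i < n ] f i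
sumFin≡∑ {zero}  f = refl
sumFin≡∑ {suc n} f = cong (f fzero +_) (sumFin≡∑ (λ i → f (fsuc i)))

∑-mono-≤ : {f g : Fin n → ℕ} → (∀ i → f i ≤ g i) → ∑[ i < n ] f i ≤ ∑[ i < n ] g i
∑-mono-≤ {zero}  f≤g = z≤n
∑-mono-≤ {suc n} f≤g = +-mono-≤ (f≤g fzero) (∑-mono-≤ (λ i → f≤g (fsuc i)))

∑-const : ∀ n c → ∑[ i < n ] c ≡ n * c
∑-const zero    c = refl
∑-const (suc n) c = cong (c +_) (∑-const n c)

edgeSum : Digraph n → (Fin n → Fin n → ℕ) → ℕ
edgeSum {n} D w = ∑[ u < n ] ∑[ v < n ] (if adj D u v then w u v else 0)

sumFin²≡edgeSum : (D : Digraph n) (w : Fin n → Fin n → ℕ) →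
  sumFin (λ u → sumFin (λ v → if adj D u v then w u v else 0)) ≡ edgeSum D w
sumFin²≡edgeSum D w =
  trans (sumFin≡∑ (λ u → sumFin (λ v → if adj D u v then w u v else 0)))
        (sum-cong-≗ (λ u → sumFin≡∑ (λ v → if adj D u v then w u v else 0)))

edgeSum-cong : (D : Digraph n) {w w′ : Fin n → Fin n → ℕ} →
  (∀ u v → w u v ≡ w′ u v) → edgeSum D w ≡ edgeSum D w′
edgeSum-cong D w≡w′ =
  sum-cong-≗ (λ u → sum-cong-≗ (λ v → cong (λ x → if adj D u v then x else 0) (w≡w′ u v)))

edgeSum-mono-≤ : (D : Digraph n) {w w′ : Fin n → Fin n → ℕ} →
  (∀ u v → w u v ≤ w′ u v) → edgeSum D w ≤ edgeSum D w′
edgeSum-mono-≤ D w≤w′ = ∑-mono-≤ (λ u → ∑-mono-≤ (λ v → masked (adj D u v) (w≤w′ u v)))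
  where
  masked : ∀ b {x y} → x ≤ y → (if b then x else 0) ≤ (if b then y else 0)
  masked true  x≤y = x≤y
  masked false _   = z≤n

edgeSum-distrib-+ : (D : Digraph n) (w w′ : Fin n → Fin n → ℕ) →
  edgeSum D (λ u v → w u v + w′ u v) ≡ edgeSum D w + edgeSum D w′
edgeSum-distrib-+ {n} D w w′ = begin
  ∑[ u < n ] ∑[ v < n ] (if adj D u v then w u v + w′ u v else 0)
    ≡⟨ sum-cong-≗ (λ u → sum-cong-≗ (λ v → masked-+ (adj D u v))) ⟩
  ∑[ u < n ] ∑[ v < n ] ((if adj D u v then w u v else 0) + (if adj D u v then w′ u v else 0))
    ≡⟨ sum-cong-≗ (λ u → ∑-distrib-+ (λ v → if adj D u v then w u v else 0)
                                     (λ v → if adj D u v then w′ u v else 0)) ⟩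
  ∑[ u < n ] (∑[ v < n ] (if adj D u v then w u v else 0) + ∑[ v < n ] (if adj D u v then w′ u v else 0))
    ≡⟨ ∑-distrib-+ (λ u → ∑[ v < n ] (if adj D u v then w u v else 0))
                   (λ u → ∑[ v < n ] (if adj D u v then w′ u v else 0)) ⟩
  edgeSum D w + edgeSum D w′ ∎
  where
  open ≡-Reasoning
  masked-+ : ∀ b {x y} → (if b then x + y else 0) ≡ (if b then x else 0) + (if b then y else 0)
  masked-+ true  = refl
  masked-+ false = refl

*-distribˡ-edgeSum : (D : Digraph n) (c : ℕ) (w : Fin n → Fin n → ℕ) →
  c * edgeSum D w ≡ edgeSum D (λ u v → c * w u v)
*-distribˡ-edgeSum {n} D c w = begin
  c * ∑[ u < n ] ∑[ v < n ] (if adj D u v then w u v else 0)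
    ≡⟨ *-distribˡ-sum c (λ u → ∑[ v < n ] (if adj D u v then w u v else 0)) ⟩
  ∑[ u < n ] (c * ∑[ v < n ] (if adj D u v then w u v else 0))
    ≡⟨ sum-cong-≗ (λ u → *-distribˡ-sum c (λ v → if adj D u v then w u v else 0)) ⟩
  ∑[ u < n ] ∑[ v < n ] (c * (if adj D u v then w u v else 0))
    ≡⟨ sum-cong-≗ (λ u → sum-cong-≗ (λ v → masked-* (adj D u v))) ⟩
  edgeSum D (λ u v → c * w u v) ∎
  where
  open ≡-Reasoning
  masked-* : ∀ b {x} → c * (if b then x else 0) ≡ (if b then c * x else 0)
  masked-* true  = refl
  masked-* false = *-zeroʳ c

edgeSum-∑ : (D : Digraph n) (m : ℕ) (w : Fin m → Fin n → Fin n → ℕ) →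
  edgeSum D (λ u v → ∑[ k < m ] w k u v) ≡ ∑[ k < m ] edgeSum D (w k)
edgeSum-∑ {n} D m w = begin
  ∑[ u < n ] ∑[ v < n ] (if adj D u v then ∑[ k < m ] w k u v else 0)
    ≡⟨ sum-cong-≗ (λ u → sum-cong-≗ (λ v → masked-∑ (adj D u v) (λ k → w k u v))) ⟩
  ∑[ u < n ] ∑[ v < n ] ∑[ k < m ] (if adj D u v then w k u v else 0)
    ≡⟨ sum-cong-≗ (λ u → ∑-comm (λ v k → if adj D u v then w k u v else 0)) ⟩
  ∑[ u < n ] ∑[ k < m ] ∑[ v < n ] (if adj D u v then w k u v else 0)
    ≡⟨ ∑-comm (λ u k → ∑[ v < n ] (if adj D u v then w k u v else 0)) ⟩
  ∑[ k < m ] edgeSum D (w k) ∎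
  where
  open ≡-Reasoning
  masked-∑ : ∀ b (f : Fin m → ℕ) →
    (if b then ∑[ k < m ] f k else 0) ≡ ∑[ k < m ] (if b then f k else 0)
  masked-∑ true  f = refl
  masked-∑ false f = sym (sum-replicate-zero m)

crossing : Bool → Bool → ℕ
crossing b c = if b then (if c then 0 else 1) else 0

cutSize≡edgeSum : (D : Digraph n) (X : Fin n → Bool) →
  cutSize D X ≡ edgeSum D (λ u v → crossing (X u) (X v))
cutSize≡edgeSum D X = sumFin²≡edgeSum D (λ u v → crossing (X u) (X v))

≤ᵇ-suc : ∀ a k → (a ≤ᵇ suc k) ≡ (pred a ≤ᵇ k)
≤ᵇ-suc zero          k = refl
≤ᵇ-suc (suc zero)    k = refl
≤ᵇ-suc (suc (suc a)) k = refl

-- crossing (a ≤ᵇ k) (b ≤ᵇ k) is the indicator of a ≤ k < b.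
∑-crossing-≤ᵇ : ∀ m a b → b ≤ m → ∑[ k < m ] crossing (a ≤ᵇ toℕ k) (b ≤ᵇ toℕ k) ≡ b ∸ a
∑-crossing-≤ᵇ zero    a b z≤n = sym (0∸n≡0 a)
∑-crossing-≤ᵇ (suc m) a b b≤1+m = begin
  crossing (a ≤ᵇ 0) (b ≤ᵇ 0) + ∑[ k < m ] crossing (a ≤ᵇ suc (toℕ k)) (b ≤ᵇ suc (toℕ k))
    ≡⟨ cong (crossing (a ≤ᵇ 0) (b ≤ᵇ 0) +_) shift ⟩
  crossing (a ≤ᵇ 0) (b ≤ᵇ 0) + ∑[ k < m ] crossing (pred a ≤ᵇ toℕ k) (pred b ≤ᵇ toℕ k)
    ≡⟨ cong (crossing (a ≤ᵇ 0) (b ≤ᵇ 0) +_) (∑-crossing-≤ᵇ m (pred a) (pred b) (pred-mono-≤ b≤1+m)) ⟩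
  crossing (a ≤ᵇ 0) (b ≤ᵇ 0) + (pred b ∸ pred a)
    ≡⟨ first-threshold a b ⟩
  b ∸ a ∎
  where
  open ≡-Reasoning
  shift : ∑[ k < m ] crossing (a ≤ᵇ suc (toℕ k)) (b ≤ᵇ suc (toℕ k))
        ≡ ∑[ k < m ] crossing (pred a ≤ᵇ toℕ k) (pred b ≤ᵇ toℕ k)
  shift = sum-cong-≗ {m} (λ k → cong₂ crossing (≤ᵇ-suc a (toℕ k)) (≤ᵇ-suc b (toℕ k)))
  first-threshold : ∀ a b → crossing (a ≤ᵇ 0) (b ≤ᵇ 0) + (pred b ∸ pred a) ≡ b ∸ a
  first-threshold zero    zero    = refl
  first-threshold zero    (suc b) = refl
  first-threshold (suc a) zero    = 0∸n≡0 a
  first-threshold (suc a) (suc b) = refl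

pos : Arrangement n → Fin n → ℕ
pos π u = toℕ (π ⟨$⟩ʳ u)

initialSegment : Arrangement n → Fin (n ∸ 1) → Fin n → Bool
initialSegment π k w = pos π w ≤ᵇ toℕ k

edgeVal≡∑-crossing : (π : Arrangement n) (u v : Fin n) →
  edgeVal π u v ≡ ∑[ k < n ∸ 1 ] crossing (initialSegment π k u) (initialSegment π k v)
edgeVal≡∑-crossing {suc n} π u v =
  sym (∑-crossing-≤ᵇ n (pos π u) (pos π v) (s≤s⁻¹ (toℕ<n (π ⟨$⟩ʳ v))))

val≤[n∸1]*t : (D : Digraph n) (t : ℕ) → (∀ X → cutSize D X ≤ t) →
  ∀ π → val D π ≤ (n ∸ 1) * t
val≤[n∸1]*t {n} D t cut≤t π = begin
  val D π
    ≡⟨ sumFin²≡edgeSum D (edgeVal π) ⟩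
  edgeSum D (edgeVal π)
    ≡⟨ edgeSum-cong D (edgeVal≡∑-crossing π) ⟩
  edgeSum D (λ u v → ∑[ k < n ∸ 1 ] crossing (initialSegment π k u) (initialSegment π k v))
    ≡⟨ edgeSum-∑ D (n ∸ 1) (λ k u v → crossing (initialSegment π k u) (initialSegment π k v)) ⟩
  ∑[ k < n ∸ 1 ] edgeSum D (λ u v → crossing (initialSegment π k u) (initialSegment π k v))
    ≡⟨ sum-cong-≗ (λ k → sym (cutSize≡edgeSum D (initialSegment π k))) ⟩
  ∑[ k < n ∸ 1 ] cutSize D (initialSegment π k)
    ≤⟨ ∑-mono-≤ (λ k → cut≤t (initialSegment π k)) ⟩
  ∑[ k < n ∸ 1 ] t
    ≡⟨ ∑-const (n ∸ 1) t ⟩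
  (n ∸ 1) * t ∎
  where open ≤-Reasoning

toℕ-punchIn-< : (i : Fin (suc n)) (j : Fin n) → toℕ j < toℕ i → toℕ (punchIn i j) ≡ toℕ j
toℕ-punchIn-< (fsuc i) fzero    _         = refl
toℕ-punchIn-< (fsuc i) (fsuc j) (s≤s j<i) = cong suc (toℕ-punchIn-< i j j<i)

toℕ-punchIn-≥ : (i : Fin (suc n)) (j : Fin n) → toℕ i ≤ toℕ j → toℕ (punchIn i j) ≡ suc (toℕ j)
toℕ-punchIn-≥ fzero    j        _         = refl
toℕ-punchIn-≥ (fsuc i) (fsuc j) (s≤s i≤j) = cong suc (toℕ-punchIn-≥ i j i≤j)

toℕ-punchIn-fromℕ : (j : Fin n) → toℕ (punchIn (fromℕ n) j) ≡ toℕ j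
toℕ-punchIn-fromℕ {n} j = toℕ-punchIn-< (fromℕ n) j (subst (toℕ j <_) (sym (toℕ-fromℕ n)) (toℕ<n j))

-- Positions x, y of a vertex in two arrangements that both list the a vertices of the first
-- block before the others, in mutually reversed orders within each block.
Mirrored : (a n : ℕ) → Bool → ℕ → ℕ → Set
Mirrored a n true  x y = x < a × y < a × suc (x + y) ≡ a
Mirrored a n false x y = a ≤ x × a ≤ y × suc (x + y) ≡ n + a

mirrored-gap : ∀ {a n xu yu xv yv} → Mirrored a n true xu yu → Mirrored a n false xv yv →
  (xv ∸ xu) + (yv ∸ yu) ≡ n
mirrored-gap {a} {n} {xu} {yu} {xv} {yv} (xu<a , yu<a , u-sum) (a≤xv , a≤yv , v-sum) =
  +-cancelʳ-≡ a _ _ (begin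
    (xv ∸ xu) + (yv ∸ yu) + a            ≡⟨ cong ((xv ∸ xu) + (yv ∸ yu) +_) (sym u-sum) ⟩
    (xv ∸ xu) + (yv ∸ yu) + suc (xu + yu) ≡⟨ interchange (xv ∸ xu) (yv ∸ yu) xu yu ⟩
    suc ((xv ∸ xu + xu) + (yv ∸ yu + yu)) ≡⟨ cong₂ (λ x y → suc (x + y))
                                                 (m∸n+n≡m (≤-trans (<⇒≤ xu<a) a≤xv))
                                                 (m∸n+n≡m (≤-trans (<⇒≤ yu<a) a≤yv)) ⟩
    suc (xv + yv)                         ≡⟨ v-sum ⟩
    n + a                                 ∎)
  where
  open ≡-Reasoning
  interchange : ∀ d e x y → d + e + suc (x + y) ≡ suc ((d + x) + (e + y))
  interchange = solve-∀

n*crossing≤gaps : ∀ {a n xu yu xv yv} b c → Mirrored a n b xu yu → Mirrored a n c xv yv →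
  n * crossing b c ≤ (xv ∸ xu) + (yv ∸ yu)
n*crossing≤gaps {n = n} true  false mu mv = ≤-reflexive (trans (*-identityʳ n) (sym (mirrored-gap mu mv)))
n*crossing≤gaps {n = n} true  true  _  _  = ≤-trans (≤-reflexive (*-zeroʳ n)) z≤n
n*crossing≤gaps {n = n} false _     _  _  = ≤-trans (≤-reflexive (*-zeroʳ n)) z≤n

record BlockArrangements (X : Fin n → Bool) : Set where
  field
    size   : Fin (suc n)
    first  : Arrangement n
    second : Arrangement n
    mirrored : ∀ u → Mirrored (toℕ size) n (X u) (pos first u) (pos second u)

mirrored-prepend : (s : Fin (suc n)) (y : Fin n) (b : Bool) {x : ℕ} →
  Mirrored (toℕ s) n b x (toℕ y) → Mirrored (suc (toℕ s)) (suc n) b (suc x) (toℕ (punchIn s y))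
mirrored-prepend s y true (x<s , y<s , x+y) rewrite toℕ-punchIn-< s y y<s =
  s≤s x<s , m<n⇒m<1+n y<s , cong suc x+y
mirrored-prepend {n} s y false {x} (s≤x , s≤y , x+y) rewrite toℕ-punchIn-≥ s y s≤y =
  s≤s s≤x , s≤s s≤y ,
  cong suc (trans (cong suc (+-suc x (toℕ y))) (trans (cong suc x+y) (sym (+-suc n (toℕ s)))))

mirrored-append : (s : Fin (suc n)) (x y : Fin n) (b : Bool) →
  Mirrored (toℕ s) n b (toℕ x) (toℕ y) →
  Mirrored (toℕ s) (suc n) b (toℕ (punchIn (fromℕ n) x)) (toℕ (punchIn s y))
mirrored-append s x y true (x<s , y<s , x+y)
  rewrite toℕ-punchIn-fromℕ x | toℕ-punchIn-< s y y<s = x<s , y<s , x+y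
mirrored-append s x y false (s≤x , s≤y , x+y)
  rewrite toℕ-punchIn-fromℕ x | toℕ-punchIn-≥ s y s≤y =
  s≤x , m≤n⇒m≤1+n s≤y , trans (cong suc (+-suc (toℕ x) (toℕ y))) (cong suc x+y)

-- A new vertex of the first block goes to the front of the first arrangement and to the end of
-- its block in the second; a new vertex of the second block goes to the end of the first
-- arrangement and to the start of its block in the second.
prependToFirstBlock : (X : Fin (suc n) → Bool) → X fzero ≡ true →
  BlockArrangements (λ i → X (fsuc i)) → BlockArrangements X
prependToFirstBlock {n} X X₀≡true B = record
  { size     = fsuc size
  ; first    = first′
  ; second   = second′
  ; mirrored = mirrored′
  }
  where
  open BlockArrangements B
  first′ second′ : Arrangement (suc n)
  first′  = insert fzero fzero first
  second′ = insert fzero size second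
  mirrored′ : ∀ u → Mirrored (suc (toℕ size)) (suc n) (X u) (pos first′ u) (pos second′ u)
  mirrored′ fzero rewrite X₀≡true = s≤s z≤n , ≤-refl , refl
  mirrored′ (fsuc k) = mirrored-prepend size (second ⟨$⟩ʳ k) (X (fsuc k)) (mirrored k)

appendToSecondBlock : (X : Fin (suc n) → Bool) → X fzero ≡ false →
  BlockArrangements (λ i → X (fsuc i)) → BlockArrangements X
appendToSecondBlock {n} X X₀≡false B = record
  { size     = inject₁ size
  ; first    = first′
  ; second   = second′
  ; mirrored = λ u → subst (λ a → Mirrored a (suc n) (X u) (pos first′ u) (pos second′ u))
                           (sym (toℕ-inject₁ size)) (mirrored′ u)
  }
  where
  open BlockArrangements B
  first′ second′ : Arrangement (suc n)
  first′  = insert fzero (fromℕ n) first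
  second′ = insert fzero size second
  mirrored′ : ∀ u → Mirrored (toℕ size) (suc n) (X u) (pos first′ u) (pos second′ u)
  mirrored′ fzero rewrite X₀≡false | toℕ-fromℕ n = s≤s⁻¹ (toℕ<n size) , ≤-refl , refl
  mirrored′ (fsuc k) =
    mirrored-append size (first ⟨$⟩ʳ k) (second ⟨$⟩ʳ k) (X (fsuc k)) (mirrored k)

blockArrangements : (X : Fin n → Bool) → BlockArrangements X
blockArrangements {zero}  X = record { size = fzero ; first = id ; second = id ; mirrored = λ () }
blockArrangements {suc n} X with X fzero in X₀≡
... | true  = prependToFirstBlock X X₀≡ (blockArrangements (λ i → X (fsuc i)))
... | false = appendToSecondBlock X X₀≡ (blockArrangements (λ i → X (fsuc i)))

n*cutSize≤val+val : (D : Digraph n) (X : Fin n → Bool) →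
  ∃₂ λ π π′ → n * cutSize D X ≤ val D π + val D π′
n*cutSize≤val+val {n} D X = first , second , (begin
  n * cutSize D X
    ≡⟨ cong (n *_) (cutSize≡edgeSum D X) ⟩
  n * edgeSum D (λ u v → crossing (X u) (X v))
    ≡⟨ *-distribˡ-edgeSum D n (λ u v → crossing (X u) (X v)) ⟩
  edgeSum D (λ u v → n * crossing (X u) (X v))
    ≤⟨ edgeSum-mono-≤ D (λ u v → n*crossing≤gaps (X u) (X v) (mirrored u) (mirrored v)) ⟩
  edgeSum D (λ u v → edgeVal first u v + edgeVal second u v)
    ≡⟨ edgeSum-distrib-+ D (edgeVal first) (edgeVal second) ⟩
  edgeSum D (edgeVal first) + edgeSum D (edgeVal second)
    ≡⟨ sym (cong₂ _+_ (sumFin²≡edgeSum D (edgeVal first)) (sumFin²≡edgeSum D (edgeVal second))) ⟩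
  val D first + val D second ∎)
  where
  open BlockArrangements (blockArrangements X)
  open ≤-Reasoning

theorem3p1 : (n : ℕ) (D : Digraph n) (t m : ℕ) →
    IsMaxDiCut D t → IsMaxVal D m →
    (n * t ≤ 2 * m) × (m ≤ (n ∸ 1) * t)
theorem3p1 n D t m ((X , cutX≡t) , cut≤t) ((π , valπ≡m) , val≤m) = lower , upper
  where
  lower : n * t ≤ 2 * m
  lower with n*cutSize≤val+val D X
  ... | π₁ , π₂ , n*cut≤vals = begin
    n * t                 ≡⟨ cong (n *_) cutX≡t ⟨
    n * cutSize D X       ≤⟨ n*cut≤vals ⟩
    val D π₁ + val D π₂   ≤⟨ +-mono-≤ (val≤m π₁) (val≤m π₂) ⟩
    m + m                 ≡⟨ cong (m +_) (+-identityʳ m) ⟨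
    2 * m                 ∎
    where open ≤-Reasoning
  upper : m ≤ (n ∸ 1) * t
  upper = subst (_≤ (n ∸ 1) * t) valπ≡m (val≤[n∸1]*t D t cut≤t π)
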